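{- Let $E$ be an equivalence relation on a set $X$, $\Gamma$ a countable group, $K\trianglelefteq\Gamma$ a normal subgroup of finite index, and $R\subseteq\Gamma$ a set of representatives of the cosets of $K$ (so every $\gamma\in\Gamma$ is uniquely $\gamma=\gamma_0 a$ with $\gamma_0\in K$, $a\in R$). Define $f\colon(X^R)^K\to X^\Gamma$ by $f(x)(\gamma a)=x(\gamma)(a)$ for $\gamma\in K$, $a\in R$. If $x,y\in(X^R)^K$, $\zeta\in K$, and $\zeta\cdot x\mathrel{(E^R)^K}y$, then $\zeta\cdot f(x)\mathrel{E^\Gamma}f(y)$. In particular, $f$ is a homomorphism from $(E^R)^{[K]}$ to $E^{[\Gamma]}$.
   Context: For a set $I$ and an equivalence relation $E$ on $X$, $E^I$ is the product relation on $X^I$: $u\mathrel{E^I}v\iff\forall i\in I\,u(i)\mathrel{E}v(i)$. A group $H$ acts on $Z^H$ by shift: $(\zeta\cdot u)(\alpha)=u(\zeta^{ -1}\alpha)$. The $H$-jump of an equivalence relation $D$ on $Z$ is $u\mathrel{D^{[H]}}v\iff\exists\zeta\in H\,(\zeta\cdot u\mathrel{D^H}v)$. A homomorphism from $D_1$ to $D_2$ is a map sending $D_1$-related points to $D_2$-related points. -}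

module Defs where

open import Level using (0ℓ)
open import Data.Nat using (ℕ)
open import Data.Fin using (Fin)
open import Data.Product using (Σ; _×_; _,_; proj₁; proj₂; ∃)
open import Relation.Binary.PropositionalEquality using (_≡_)
open import Relation.Binary.Core using (Rel)
open import Algebra.Core using (Op₁; Op₂)
open import Algebra.Structures using (IsGroup)
open import Function.Definitions using (Injective)
open import Function.Bundles using (_↔_)

record PGroup : Set₁ where
  field
    Carrier : Set
    _∙_     : Op₂ Carrier
    ε       : Carrier
    _⁻¹     : Op₁ Carrier
    isGroup : IsGroup _≡_ _∙_ ε _⁻¹
  infixl 7 _∙_
  infix  8 _⁻¹

Countable : Set → Set
Countable A = Σ (A → ℕ) λ ι → Injective _≡_ _≡_ ι

IsProp : {A : Set} → (A → Set) → Set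
IsProp {A} P = ∀ a (p q : P a) → p ≡ q

module _ (Γ : PGroup) where
  open PGroup Γ

  record Subgroup : Set₁ where
    field
      mem     : Carrier → Set
      mem-prop : IsProp mem
      ε-mem   : mem ε
      ∙-mem   : ∀ {a b} → mem a → mem b → mem (a ∙ b)
      ⁻¹-mem  : ∀ {a} → mem a → mem (a ⁻¹)

  Normal : Subgroup → Set
  Normal K = ∀ g k → Subgroup.mem K k → Subgroup.mem K (g ∙ k ∙ g ⁻¹)

  IsCosetReps : Subgroup → (R : Carrier → Set) → Set
  IsCosetReps K R =
    IsProp R
    × (∀ γ → Σ Carrier λ γ₀ → Σ Carrier λ a →
          Subgroup.mem K γ₀ × R a × γ ≡ γ₀ ∙ a)
    × (∀ γ₀ a γ₀' a' → Subgroup.mem K γ₀ → R a → Subgroup.mem K γ₀' → R a' →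
          γ₀ ∙ a ≡ γ₀' ∙ a' → (γ₀ ≡ γ₀') × (a ≡ a'))

  FiniteIndex : Subgroup → Set₁
  FiniteIndex K = ∃ λ (n : ℕ) → Σ (Carrier → Set) λ R →
    IsCosetReps K R × (Fin n ↔ Σ Carrier R)

  shift : {Z : Set} → Carrier → (Carrier → Z) → (Carrier → Z)
  shift ζ u α = u (ζ ⁻¹ ∙ α)

  shiftK : (K : Subgroup) {Z : Set} → Σ Carrier (Subgroup.mem K) →
           (Σ Carrier (Subgroup.mem K) → Z) → (Σ Carrier (Subgroup.mem K) → Z)
  shiftK K (ζ , pζ) u (α , pα) =
    u (ζ ⁻¹ ∙ α , Subgroup.∙-mem K (Subgroup.⁻¹-mem K pζ) pα)

ProdRel : (I : Set) {X : Set} → Rel X 0ℓ → Rel (I → X) 0ℓ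
ProdRel I E u v = ∀ i → E (u i) (v i)

JumpΓ : (Γ : PGroup) {Z : Set} → Rel Z 0ℓ → Rel (PGroup.Carrier Γ → Z) 0ℓ
JumpΓ Γ D u v = Σ (PGroup.Carrier Γ) λ ζ → ProdRel (PGroup.Carrier Γ) D (shift Γ ζ u) v

JumpK : (Γ : PGroup) (K : Subgroup Γ) {Z : Set} → Rel Z 0ℓ →
        Rel (Σ (PGroup.Carrier Γ) (Subgroup.mem K) → Z) 0ℓ
JumpK Γ K D u v = Σ (Σ (PGroup.Carrier Γ) (Subgroup.mem K)) λ ζ →
  ProdRel (Σ (PGroup.Carrier Γ) (Subgroup.mem K)) D (shiftK Γ K ζ u) v

IsHom : {A B : Set} → Rel A 0ℓ → Rel B 0ℓ → (A → B) → Set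
IsHom D₁ D₂ f = ∀ u v → D₁ u v → D₂ (f u) (f v)

{-# OPTIONS --safe #-}
module Submission where

open import Defs
open import Data.Product using (Σ; _×_; _,_; proj₁)
open import Relation.Binary.PropositionalEquality using (_≡_; refl; sym; cong; trans; subst₂)
open import Algebra.Structures using (IsGroup)
open import Relation.Binary.Core using (Rel)
open import Relation.Binary.Structures using (IsEquivalence)

-- Since ζ ∈ K, the shift by ζ⁻¹ moves γ a to (ζ⁻¹ γ) a, keeping the coset representative a
-- and acting on the K-coordinate only.  Neither normality nor finiteness of the index,
-- uniqueness of the decomposition, or any property of E is needed.
module _ (Γ : PGroup) (K : Subgroup Γ) (R : PGroup.Carrier Γ → Set) where
  open PGroup Γ
  open Subgroup K

  private
    K̃ R̃ : Set
    K̃ = Σ Carrier mem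
    R̃ = Σ Carrier R

  KRDecomposition : Set
  KRDecomposition = ∀ γ → Σ Carrier λ γ₀ → Σ Carrier λ a → mem γ₀ × R a × γ ≡ γ₀ ∙ a

  module _ {X : Set}
           (f : (K̃ → R̃ → X) → Carrier → X)
           (f-∙ : ∀ x γ a (pγ : mem γ) (pa : R a) → f x (γ ∙ a) ≡ x (γ , pγ) (a , pa))
           where

    shift-f-∙ : ∀ x (ζ : K̃) γ a (pγ : mem γ) (pa : R a) →
                shift Γ (proj₁ ζ) (f x) (γ ∙ a) ≡ shiftK Γ K ζ x (γ , pγ) (a , pa)
    shift-f-∙ x (ζ , pζ) γ a pγ pa =
      trans (cong (f x) (sym (IsGroup.assoc isGroup (ζ ⁻¹) γ a)))
            (f-∙ x (ζ ⁻¹ ∙ γ) a (∙-mem (⁻¹-mem pζ) pγ) pa)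

    shift-f-preserves-ProdRel :
      KRDecomposition →
      (E : Rel X _) →
      ∀ x y ζ → ProdRel K̃ (ProdRel R̃ E) (shiftK Γ K ζ x) y →
      ProdRel Carrier E (shift Γ (proj₁ ζ) (f x)) (f y)
    shift-f-preserves-ProdRel decompose E x y ζ ζx≈y γ with decompose γ
    ... | γ₀ , a , pγ₀ , pa , refl =
      subst₂ E (sym (shift-f-∙ x ζ γ₀ a pγ₀ pa)) (sym (f-∙ y γ₀ a pγ₀ pa))
             (ζx≈y (γ₀ , pγ₀) (a , pa))

    f-isHom-Jump :
      KRDecomposition →
      (E : Rel X _) → IsHom (JumpK Γ K (ProdRel R̃ E)) (JumpΓ Γ E) f
    f-isHom-Jump decompose E x y (ζ , ζx≈y) =
      proj₁ ζ , shift-f-preserves-ProdRel decompose E x y ζ ζx≈y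

mainTheorem8 : (X : Set) (E : Rel X _) → IsEquivalence E →
    (Γ : PGroup) → Countable (PGroup.Carrier Γ) →
    (K : Subgroup Γ) → Normal Γ K → FiniteIndex Γ K →
    (R : PGroup.Carrier Γ → Set) → IsCosetReps Γ K R →
    (f : (Σ (PGroup.Carrier Γ) (Subgroup.mem K) → Σ (PGroup.Carrier Γ) R → X)
         → PGroup.Carrier Γ → X) →
    (∀ x γ a (pγ : Subgroup.mem K γ) (pa : R a) →
       f x (PGroup._∙_ Γ γ a) ≡ x (γ , pγ) (a , pa)) →
    (∀ x y ζ →
       ProdRel (Σ (PGroup.Carrier Γ) (Subgroup.mem K))
               (ProdRel (Σ (PGroup.Carrier Γ) R) E) (shiftK Γ K ζ x) y →
       ProdRel (PGroup.Carrier Γ) E (shift Γ (proj₁ ζ) (f x)) (f y))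
    × IsHom (JumpK Γ K (ProdRel (Σ (PGroup.Carrier Γ) R) E)) (JumpΓ Γ E) f
mainTheorem8 X E _ Γ _ K _ _ R (_ , decompose , _) f f-∙ =
  shift-f-preserves-ProdRel Γ K R f f-∙ decompose E , f-isHom-Jump Γ K R f f-∙ decompose E
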